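{- Let $s,t,k,d,q\in\mathbb{N}$ and $t':=(2d(k-1)(s+q-1)+1)(t-1)+1+sd$. Let $\mathcal{P}$ be a $(k,d)^\star$-shortcut system for a graph $G$. If $G^{\mathcal{P}}$ contains a $(1,q)$-model of $K_{s,t'}$, then $G$ contains a $(1,\ q+(k-1)(s+q-1))$-model of $K_{s,t}$.
   Context: All graphs are finite, simple and undirected. A shortcut system for a graph $G$ is a set $\mathcal{P}$ of paths in $G$ each with at least one edge; a path in $\mathcal{P}$ with endpoints $v,w$ is a $vw$-shortcut. $G^{\mathcal{P}}$ is the simple supergraph of $G$ obtained by adding the edge $vw$ for each $vw$-shortcut in $\mathcal{P}$. $\mathcal{P}$ is a $(k,d)^\star$-shortcut system if every path in $\mathcal{P}$ has length at most $k$, and for every $v\in V(G)$, the set $M_v$ of vertices $u\in V(G)$ for which there exists a $uw$-shortcut in $\mathcal{P}$ having $v$ as an internal vertex satisfies $|M_v|\le d$. For $p,q\in\mathbb{N}$, a $(p,q)$-model of $K_{a,b}$ in a graph $G$ is a family $\{X_1,\dots,X_a;Y_1,\dots,Y_b\}$ of pairwise disjoint connected subgraphs of $G$ such that for each $i\in[a]$, $j\in[b]$ there is an edge of $G$ between $X_i$ and $Y_j$, $|V(X_i)|\le p$ for all $i$, and $|V(Y_j)|\le q$ for all $j$. -}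

module Defs where

open import Data.Nat using (ℕ; zero; suc; _+_; _*_; _∸_; _≤_; _≥_)
open import Data.Fin using (Fin)
open import Data.List using (List; []; _∷_; length)
open import Data.List.Membership.Propositional using (_∈_; _∉_)
open import Data.List.Relation.Unary.Unique.Propositional using (Unique)
open import Data.Product using (Σ; ∃; ∃-syntax; _×_; _,_)
open import Data.Sum using (_⊎_)
open import Data.Maybe using (Maybe; just; nothing)
open import Relation.Nullary using (¬_; Dec)
open import Relation.Binary.PropositionalEquality using (_≡_; _≢_)

record Graph (n : ℕ) : Set₁ where
  field
    Adj     : Fin n → Fin n → Set
    sym     : ∀ {u v} → Adj u v → Adj v u
    irrefl  : ∀ {u} → ¬ Adj u u
    decAdj  : ∀ u v → Dec (Adj u v)
open Graph public

data Chain {n : ℕ} (R : Fin n → Fin n → Set) : List (Fin n) → Set where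
  []  : Chain R []
  [-] : ∀ x → Chain R (x ∷ [])
  _∷_ : ∀ {x y xs} → R x y → Chain R (y ∷ xs) → Chain R (x ∷ y ∷ xs)

record Path {n : ℕ} (G : Graph n) : Set where
  field
    start     : Fin n
    inner     : List (Fin n)
    end       : Fin n
    distinct  : Unique (start ∷ inner Data.List.++ (end ∷ []))
    adjacent  : Chain (Adj G) (start ∷ inner Data.List.++ (end ∷ []))
open Path public

pathLength : ∀ {n} {G : Graph n} → Path G → ℕ
pathLength P = suc (length (inner P))

IsShortcut : ∀ {n} {G : Graph n} → Path G → Fin n → Fin n → Set
IsShortcut P v w = (start P ≡ v × end P ≡ w) ⊎ (start P ≡ w × end P ≡ v)

ShortcutSystem : ∀ {n} → Graph n → Set
ShortcutSystem G = List (Path G)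

AdjP : ∀ {n} (G : Graph n) → ShortcutSystem G → Fin n → Fin n → Set
AdjP G 𝒫 u v = Adj G u v ⊎ (∃[ P ] (P ∈ 𝒫 × IsShortcut P u v))

-- u ∈ M_v : there is a uw-shortcut in 𝒫 having v as an internal vertex
InM : ∀ {n} {G : Graph n} → ShortcutSystem G → Fin n → Fin n → Set
InM {n} 𝒫 v u = ∃[ P ] ∃[ w ] (P ∈ 𝒫 × IsShortcut P u w × v ∈ inner P)

CardLe : ∀ {n} → (Fin n → Set) → ℕ → Set
CardLe {n} S d = ∀ (us : List (Fin n)) → Unique us → (∀ {u} → u ∈ us → S u) → length us ≤ d

IsKDStar : ∀ {n} {G : Graph n} → ShortcutSystem G → ℕ → ℕ → Set
IsKDStar {n} 𝒫 k d =
  (∀ {P} → P ∈ 𝒫 → pathLength P ≤ k) × (∀ (v : Fin n) → CardLe (InM 𝒫 v) d)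

data Reach {n} (R : Fin n → Fin n → Set) (S : List (Fin n)) : Fin n → Fin n → Set where
  here : ∀ {u} → Reach R S u u
  step : ∀ {u v w} → Reach R S u v → R v w → w ∈ S → Reach R S u w

Connected : ∀ {n} → (Fin n → Fin n → Set) → List (Fin n) → Set
Connected R S = (S ≢ []) × (∀ {u v} → u ∈ S → v ∈ S → Reach R S u v)

Disjoint : ∀ {n} → List (Fin n) → List (Fin n) → Set
Disjoint A B = ∀ {x} → x ∈ A → x ∉ B

record Model {n} (R : Fin n → Fin n → Set) (p q a b : ℕ) : Set where
  field
    X : Fin a → List (Fin n)
    Y : Fin b → List (Fin n)
    X-unique : ∀ i → Unique (X i)
    Y-unique : ∀ j → Unique (Y j)
    X-conn   : ∀ i → Connected R (X i)
    Y-conn   : ∀ j → Connected R (Y j)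
    XX-disj  : ∀ i i' → i ≢ i' → Disjoint (X i) (X i')
    YY-disj  : ∀ j j' → j ≢ j' → Disjoint (Y j) (Y j')
    XY-disj  : ∀ i j → Disjoint (X i) (Y j)
    edge     : ∀ i j → ∃[ x ] ∃[ y ] (x ∈ X i × y ∈ Y j × R x y)
    X-size   : ∀ i → length (X i) ≤ p
    Y-size   : ∀ j → length (Y j) ≤ q

-- The branch sets Y j are connected in G^𝒫, and every branch vertex x i has a G^𝒫-neighbour
-- in each of them.  Replacing the |Y j| - 1 edges of a spanning tree of Y j, and one
-- attaching edge per x i, by the paths of their shortcuts gives a set Z j ⊇ Y j that is
-- connected in G and adjacent to every x i; the at most (k-1)(s+q-1) new vertices U j are
-- interior to shortcuts ending in Y j, i.e. their sets M_u meet Y j.  Thus Z j can contain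
-- x i only if M_(x i) meets Y j, which by disjointness of the Y j excludes at most s·d
-- indices.  Two sets Z j, Z j' can only meet if some u ∈ U j lies in Y j' or M_u meets Y j';
-- since M_u already meets Y j, each u conflicts with at most d indices j', so the conflict
-- digraph has out-degree at most d(k-1)(s+q-1), and a vertex of below-average degree can be
-- picked greedily t times among the (2d(k-1)(s+q-1)+1)(t-1)+1 remaining indices.
module Submission where

open import Data.Fin using (Fin) renaming (zero to fzero; suc to fsuc)
open import Data.Fin.Properties using (_≟_)
open import Data.List using (List; []; _∷_; _++_; [_]; length; map; filter; allFin; deduplicate)
open import Data.List.Membership.Propositional using (_∈_; _∉_; find; lose)
import Data.List.Membership.DecPropositional
open import Data.List.Membership.Propositional.Properties
  using (∈-++⁺ˡ; ∈-++⁺ʳ; ∈-++⁻; ∈-filter⁻; ∈-map⁺; ∈-map⁻; ∈-allFin; ∈-deduplicate⁺; ∈-deduplicate⁻)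
open import Data.List.Properties using (map-cong; length-++; length-map; length-tabulate; filter-none; length-deduplicate)
open import Data.List.Relation.Binary.Subset.Propositional using (_⊆_)
open import Data.List.Relation.Binary.Subset.Propositional.Properties using (xs⊆ys++xs; ++⁺)
open import Data.List.Relation.Unary.All as All using (All; []; _∷_; all?)
open import Data.List.Relation.Unary.All.Properties using (¬All⇒Any¬)
open import Data.List.Relation.Unary.AllPairs using ([]; _∷_)
open import Data.List.Relation.Unary.Any using (Any; here; there; any?; _─_)
open import Data.List.Relation.Unary.Unique.Propositional using (Unique)
open import Data.List.Relation.Unary.Unique.Propositional.Properties using (filter⁺; allFin⁺)
open import Data.List.Relation.Unary.Unique.DecPropositional.Properties using (deduplicate-!)
open import Data.Nat using (ℕ; zero; suc; _+_; _*_; _∸_; _≤_; _<_; z≤n; s≤s)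
open import Data.Nat.Induction using (<-wellFounded)
open import Data.Nat.ListAction using (sum)
open import Data.Nat.Properties hiding (_≟_)
open import Data.Nat.Tactic.RingSolver using (solve-∀)
open import Data.Product using (∃-syntax; _×_; _,_; proj₁; proj₂)
open import Data.Sum using (_⊎_; inj₁; inj₂; swap)
import Data.Vec.Functional as Vector
open import Function using (_∘_)
open import Function.Definitions using (Injective)
open import Induction.WellFounded using (Acc; acc)
open import Relation.Binary.Definitions using (DecidableEquality)
open import Relation.Binary.PropositionalEquality
  using (_≡_; _≢_; refl; trans; cong; subst; module ≡-Reasoning)
  renaming (sym to ≡-sym)
open import Relation.Nullary using (Dec; yes; no; ¬_; contradiction)
open import Relation.Nullary.Decidable using (_×-dec_; _⊎-dec_; ¬?; map′)
open import Relation.Unary using (Decidable)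

open import Defs

private
  variable
    A B : Set

indicator : {P : Set} → Dec P → ℕ
indicator (yes _) = 1
indicator (no _)  = 0

count : {P : A → Set} → Decidable P → List A → ℕ
count P? []       = 0
count P? (x ∷ xs) = indicator (P? x) + count P? xs

module _ {P : A → Set} (P? : Decidable P) where

  length-filter≡count : ∀ xs → length (filter P? xs) ≡ count P? xs
  length-filter≡count []       = refl
  length-filter≡count (x ∷ xs) with P? x
  ... | yes _ = cong suc (length-filter≡count xs)
  ... | no _  = length-filter≡count xs

  count+count¬≡length : ∀ xs → count P? xs + count (¬? ∘ P?) xs ≡ length xs
  count+count¬≡length []       = refl
  count+count¬≡length (x ∷ xs) with P? x
  ... | yes _ = cong suc (count+count¬≡length xs)
  ... | no _  = trans (+-suc (count P? xs) _) (cong suc (count+count¬≡length xs))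

  count≡sum-indicator : ∀ xs → count P? xs ≡ sum (map (indicator ∘ P?) xs)
  count≡sum-indicator []       = refl
  count≡sum-indicator (x ∷ xs) = cong (indicator (P? x) +_) (count≡sum-indicator xs)

  count-none : ∀ {xs} → (∀ {x} → x ∈ xs → ¬ P x) → count P? xs ≡ 0
  count-none {xs} none = trans (≡-sym (length-filter≡count xs))
    (cong length (filter-none P? (All.tabulate none)))

count-mono : {P Q : A → Set} (P? : Decidable P) (Q? : Decidable Q) →
  (∀ {x} → P x → Q x) → ∀ xs → count P? xs ≤ count Q? xs
count-mono P? Q? P⇒Q []       = z≤n
count-mono P? Q? P⇒Q (x ∷ xs) with P? x | Q? x
... | yes _  | yes _  = s≤s (count-mono P? Q? P⇒Q xs)
... | yes px | no ¬qx = contradiction (P⇒Q px) ¬qx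
... | no _   | yes _  = m≤n⇒m≤1+n (count-mono P? Q? P⇒Q xs)
... | no _   | no _   = count-mono P? Q? P⇒Q xs

count-⊎ : {P Q : A → Set} (P? : Decidable P) (Q? : Decidable Q) →
  ∀ xs → count (λ x → P? x ⊎-dec Q? x) xs ≤ count P? xs + count Q? xs
count-⊎ P? Q? []       = z≤n
count-⊎ P? Q? (x ∷ xs) with ih ← count-⊎ P? Q? xs | P? x | Q? x
... | yes _ | yes _ = s≤s (≤-trans ih (+-monoʳ-≤ (count P? xs) (n≤1+n _)))
... | yes _ | no _  = s≤s ih
... | no _  | yes _ = ≤-trans (s≤s ih) (≤-reflexive (≡-sym (+-suc (count P? xs) _)))
... | no _  | no _  = ih

count-union : {R P Q : A → Set} (R? : Decidable R) (P? : Decidable P) (Q? : Decidable Q) →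
  (∀ {x} → R x → P x ⊎ Q x) → ∀ xs → count R? xs ≤ count P? xs + count Q? xs
count-union R? P? Q? R⇒P⊎Q xs =
  ≤-trans (count-mono R? (λ x → P? x ⊎-dec Q? x) R⇒P⊎Q xs) (count-⊎ P? Q? xs)

count-Any : {R : A → Set} {S : B → A → Set} (R? : Decidable R) (S? : ∀ b → Decidable (S b)) →
  ∀ bs → (∀ {x} → R x → Any (λ b → S b x) bs) →
  ∀ xs → count R? xs ≤ sum (map (λ b → count (S? b) xs) bs)
count-Any R? S? [] R⇒Any xs = ≤-reflexive (count-none R? {xs} (λ _ r → case-[] (R⇒Any r)))
  where
  case-[] : ∀ {P : B → Set} → ¬ Any P []
  case-[] ()
count-Any {R = R} {S} R? S? (b ∷ bs) R⇒Any xs = begin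
  count R? xs                                            ≤⟨ count-union R? (S? b) Any? split xs ⟩
  count (S? b) xs + count Any? xs                        ≤⟨ +-monoʳ-≤ _ (count-Any Any? S? bs (λ p → p) xs) ⟩
  count (S? b) xs + sum (map (λ b → count (S? b) xs) bs) ∎
  where
  open ≤-Reasoning
  Any? = λ x → any? (λ b → S? b x) bs
  split : ∀ {x} → R x → S b x ⊎ Any (λ b → S b x) bs
  split r with R⇒Any r
  ... | here s   = inj₁ s
  ... | there ss = inj₂ ss

count-≡-≤1 : (_≟ᴬ_ : DecidableEquality A) (a : A) → ∀ {xs} → Unique xs → count (_≟ᴬ a) xs ≤ 1
count-≡-≤1 _≟ᴬ_ a {[]}     []           = z≤n
count-≡-≤1 _≟ᴬ_ a {x ∷ xs} (x∉xs ∷ uxs) with x ≟ᴬ a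
... | yes refl = s≤s (≤-reflexive (count-none (_≟ᴬ a) (λ y∈ y≡x → All.lookup x∉xs y∈ (≡-sym y≡x))))
... | no _     = count-≡-≤1 _≟ᴬ_ a uxs

sum-map-+ : (f g : A → ℕ) → ∀ xs → sum (map (λ x → f x + g x) xs) ≡ sum (map f xs) + sum (map g xs)
sum-map-+ f g []       = refl
sum-map-+ f g (x ∷ xs) = trans (cong (f x + g x +_) (sum-map-+ f g xs))
  (+-assoc-comm (f x) (g x) (sum (map f xs)) (sum (map g xs)))
  where
  +-assoc-comm : ∀ a b c d → (a + b) + (c + d) ≡ (a + c) + (b + d)
  +-assoc-comm = solve-∀

sum-map-0 : (xs : List A) → sum (map (λ _ → 0) xs) ≡ 0
sum-map-0 []       = refl
sum-map-0 (_ ∷ xs) = sum-map-0 xs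

sum-map-swap : (f : A → B → ℕ) → ∀ as bs →
  sum (map (λ a → sum (map (f a) bs)) as) ≡ sum (map (λ b → sum (map (λ a → f a b) as)) bs)
sum-map-swap f []       bs = ≡-sym (sum-map-0 bs)
sum-map-swap f (a ∷ as) bs = begin
  sum (map (f a) bs) + sum (map (λ a → sum (map (f a) bs)) as)
    ≡⟨ cong (sum (map (f a) bs) +_) (sum-map-swap f as bs) ⟩
  sum (map (f a) bs) + sum (map (λ b → sum (map (λ a → f a b) as)) bs)
    ≡⟨ ≡-sym (sum-map-+ (f a) (λ b → sum (map (λ a → f a b) as)) bs) ⟩
  sum (map (λ b → f a b + sum (map (λ a → f a b) as)) bs) ∎
  where open ≡-Reasoning

count-swap : {R : A → B → Set} (R? : ∀ a b → Dec (R a b)) → ∀ as bs →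
  sum (map (λ a → count (R? a) bs) as) ≡ sum (map (λ b → count (λ a → R? a b) as) bs)
count-swap R? as bs = begin
  sum (map (λ a → count (R? a) bs) as)
    ≡⟨ cong sum (map-cong (λ a → count≡sum-indicator (R? a) bs) as) ⟩
  sum (map (λ a → sum (map (indicator ∘ R? a) bs)) as)
    ≡⟨ sum-map-swap (λ a b → indicator (R? a b)) as bs ⟩
  sum (map (λ b → sum (map (λ a → indicator (R? a b)) as)) bs)
    ≡⟨ cong sum (map-cong (λ b → ≡-sym (count≡sum-indicator (λ a → R? a b) as)) bs) ⟩
  sum (map (λ b → count (λ a → R? a b) as) bs) ∎
  where open ≡-Reasoning

sum-map-mono : {f g : A → ℕ} → ∀ xs → (∀ {x} → x ∈ xs → f x ≤ g x) → sum (map f xs) ≤ sum (map g xs)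
sum-map-mono []       f≤g = z≤n
sum-map-mono (x ∷ xs) f≤g = +-mono-≤ (f≤g (here refl)) (sum-map-mono xs (f≤g ∘ there))

sum-map-≤ : {f : A → ℕ} {c : ℕ} → ∀ xs → (∀ {x} → x ∈ xs → f x ≤ c) → sum (map f xs) ≤ length xs * c
sum-map-≤ []       f≤c = z≤n
sum-map-≤ (x ∷ xs) f≤c = +-mono-≤ (f≤c (here refl)) (sum-map-≤ xs (f≤c ∘ there))

∃-≤-average : (f : A → ℕ) (c : ℕ) → ∀ x xs → sum (map f (x ∷ xs)) ≤ length (x ∷ xs) * c →
  ∃[ y ] (y ∈ x ∷ xs × f y ≤ c)
∃-≤-average f c x xs Σ≤ with f x ≤? c
... | yes fx≤c = x , here refl , fx≤c
... | no fx≰c with xs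
...   | [] = contradiction (≤-trans (m≤m+n (f x) 0) (≤-trans Σ≤ (≤-reflexive (+-identityʳ c)))) fx≰c
...   | x′ ∷ xs′ with ∃-≤-average f c x′ xs′ (+-cancelˡ-≤ c _ _ (≤-trans (+-monoˡ-≤ _ (<⇒≤ (≰⇒> fx≰c))) Σ≤))
...     | y , y∈ , fy≤c = y , there y∈ , fy≤c

module _ {x : A} where

  length-─ : ∀ {xs} (p : x ∈ xs) → length xs ≡ suc (length (xs ─ p))
  length-─ (here _)  = refl
  length-─ (there p) = cong suc (length-─ p)

  ∈-─ : ∀ {xs y} (p : x ∈ xs) → y ∈ xs → y ≡ x ⊎ y ∈ (xs ─ p)
  ∈-─ (here refl) (here y≡x) = inj₁ y≡x
  ∈-─ (here _)    (there q)  = inj₂ q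
  ∈-─ (there p)   (here y≡z) = inj₂ (here y≡z)
  ∈-─ (there p)   (there q)  with ∈-─ p q
  ... | inj₁ y≡x = inj₁ y≡x
  ... | inj₂ q′  = inj₂ (there q′)

nonempty-≤1⇒singleton : ∀ {l : List A} → l ≢ [] → length l ≤ 1 → ∃[ v ] (l ≡ [ v ])
nonempty-≤1⇒singleton {l = []}          l≢[] _ = contradiction refl l≢[]
nonempty-≤1⇒singleton {l = v ∷ []}      _    _ = v , refl
nonempty-≤1⇒singleton {l = _ ∷ _ ∷ _} _    (s≤s ())

module IndependentSet {B : Set} (_≟ᴮ_ : DecidableEquality B)
  {Arc : B → B → Set} (Arc? : ∀ a b → Dec (Arc a b)) (D : ℕ)
  (out-degree : ∀ a {L} → Unique L → count (Arc? a) L ≤ D) where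

  Adjacent : B → B → Set
  Adjacent a b = Arc a b ⊎ Arc b a

  adjacent? : ∀ a b → Dec (Adjacent a b)
  adjacent? a b = Arc? a b ⊎-dec Arc? b a

  degree : List B → B → ℕ
  degree L a = count (adjacent? a) L

  degree-sum : ∀ {L} → Unique L → sum (map (degree L) L) ≤ length L * (D + D)
  degree-sum {L} uL = begin
    sum (map (degree L) L)
      ≤⟨ sum-map-mono L (λ {a} _ → count-⊎ (Arc? a) (λ b → Arc? b a) L) ⟩
    sum (map (λ a → out a + count (λ b → Arc? b a) L) L)
      ≡⟨ sum-map-+ out (λ a → count (λ b → Arc? b a) L) L ⟩
    sum (map out L) + sum (map (λ a → count (λ b → Arc? b a) L) L)
      ≡⟨ cong (sum (map out L) +_) (≡-sym (count-swap Arc? L L)) ⟩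
    sum (map out L) + sum (map out L)
      ≤⟨ +-mono-≤ Σout≤ Σout≤ ⟩
    length L * D + length L * D
      ≡⟨ ≡-sym (*-distribˡ-+ (length L) D D) ⟩
    length L * (D + D) ∎
    where
    open ≤-Reasoning
    out : B → ℕ
    out a = count (Arc? a) L
    Σout≤ : sum (map out L) ≤ length L * D
    Σout≤ = sum-map-≤ L (λ {a} _ → out-degree a uL)

  Near : B → B → Set
  Near a b = b ≡ a ⊎ Adjacent a b

  near? : ∀ a b → Dec (Near a b)
  near? a b = (b ≟ᴮ a) ⊎-dec adjacent? a b

  ∃-vertex-with-small-neighbourhood : ∀ {b L} → Unique (b ∷ L) →
    ∃[ a ] (a ∈ b ∷ L × length (b ∷ L) ≤ length (filter (¬? ∘ near? a) (b ∷ L)) + suc (D + D))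
  ∃-vertex-with-small-neighbourhood {b} {L} u
    with ∃-≤-average (degree (b ∷ L)) (D + D) b L (degree-sum u)
  ... | a , a∈ , degree≤ = a , a∈ , (begin
    length (b ∷ L)
      ≡⟨ ≡-sym (count+count¬≡length (near? a) (b ∷ L)) ⟩
    count (near? a) (b ∷ L) + count (¬? ∘ near? a) (b ∷ L)
      ≡⟨ +-comm (count (near? a) (b ∷ L)) _ ⟩
    count (¬? ∘ near? a) (b ∷ L) + count (near? a) (b ∷ L)
      ≤⟨ +-mono-≤ (≤-reflexive (≡-sym (length-filter≡count (¬? ∘ near? a) (b ∷ L)))) near≤ ⟩
    length (filter (¬? ∘ near? a) (b ∷ L)) + suc (D + D) ∎)
    where
    open ≤-Reasoning
    near≤ : count (near? a) (b ∷ L) ≤ suc (D + D)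
    near≤ = ≤-trans (count-⊎ (_≟ᴮ a) (adjacent? a) (b ∷ L)) (+-mono-≤ (count-≡-≤1 _≟ᴮ_ a u) degree≤)

  record Independent (m : ℕ) (L : List B) : Set where
    field
      pick             : Fin m → B
      pick-∈           : ∀ i → pick i ∈ L
      pick-injective   : Injective _≡_ _≡_ pick
      pick-independent : ∀ {i j} → i ≢ j → ¬ Arc (pick i) (pick j)

  private
    recursion-bound : ∀ E m ℓ ℓ′ → suc E * suc m ≤ ℓ + E → ℓ ≤ ℓ′ + suc E → suc E * m ≤ ℓ′ + E
    recursion-bound E m ℓ ℓ′ bound ℓ≤ = +-cancelˡ-≤ (suc E) _ _ (begin
      suc E + suc E * m  ≡⟨ ≡-sym (*-suc (suc E) m) ⟩
      suc E * suc m      ≤⟨ bound ⟩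
      ℓ + E              ≤⟨ +-monoˡ-≤ E ℓ≤ ⟩
      ℓ′ + suc E + E     ≡⟨ shuffle ℓ′ E ⟩
      suc E + (ℓ′ + E)   ∎)
      where
      open ≤-Reasoning
      shuffle : ∀ ℓ′ E → ℓ′ + suc E + E ≡ suc E + (ℓ′ + E)
      shuffle = solve-∀

  cons-far : ∀ {m a L} → a ∈ L → Independent m (filter (¬? ∘ near? a) L) → Independent (suc m) L
  cons-far {a = a} {L} a∈L I = record
    { pick             = a Vector.∷ pick
    ; pick-∈           = λ { fzero → a∈L ; (fsuc i) → proj₁ (∈-filter⁻ (¬? ∘ near? a) {xs = L} (pick-∈ i)) }
    ; pick-injective   = injective
    ; pick-independent = no-arc }
    where
    open Independent I
    far : ∀ i → ¬ Near a (pick i)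
    far i = proj₂ (∈-filter⁻ (¬? ∘ near? a) {xs = L} (pick-∈ i))
    injective : Injective _≡_ _≡_ (a Vector.∷ pick)
    injective {fzero}  {fzero}  _  = refl
    injective {fzero}  {fsuc j} eq = contradiction (inj₁ (≡-sym eq)) (far j)
    injective {fsuc i} {fzero}  eq = contradiction (inj₁ eq) (far i)
    injective {fsuc i} {fsuc j} eq = cong fsuc (pick-injective eq)
    no-arc : ∀ {i j} → i ≢ j → ¬ Arc ((a Vector.∷ pick) i) ((a Vector.∷ pick) j)
    no-arc {fzero}  {fzero}  i≢j = contradiction refl i≢j
    no-arc {fzero}  {fsuc j} _   = far j ∘ inj₂ ∘ inj₁
    no-arc {fsuc i} {fzero}  _   = far i ∘ inj₂ ∘ inj₂
    no-arc {fsuc i} {fsuc j} i≢j = pick-independent (i≢j ∘ cong fsuc)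

  independent : ∀ m {L} → Unique L → suc (D + D) * m ≤ length L + (D + D) → Independent m L
  independent zero    _ _ = record
    { pick = λ () ; pick-∈ = λ () ; pick-injective = λ { {()} } ; pick-independent = λ { {()} } }
  independent (suc m) {[]} _ bound =
    contradiction (≤-trans (m≤m*n (suc (D + D)) (suc m)) bound) 1+n≰n
  independent (suc m) {b ∷ L} u bound =
    let a , a∈ , length≤ = ∃-vertex-with-small-neighbourhood u in
    cons-far a∈ (independent m (filter⁺ (¬? ∘ near? a) u)
      (recursion-bound (D + D) m (length (b ∷ L)) (length (filter (¬? ∘ near? a) (b ∷ L))) bound length≤))

_∈?_ : ∀ {n} (v : Fin n) (vs : List (Fin n)) → Dec (v ∈ vs)
_∈?_ = Data.List.Membership.DecPropositional._∈?_ _≟_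

module _ {n : ℕ} {R : Fin n → Fin n → Set} where

  reach-mono : ∀ {S S′ a b} → S ⊆ S′ → Reach R S a b → Reach R S′ a b
  reach-mono S⊆S′ here            = here
  reach-mono S⊆S′ (step r e w∈S) = step (reach-mono S⊆S′ r) e (S⊆S′ w∈S)

  reach-trans : ∀ {S a b c} → Reach R S a b → Reach R S b c → Reach R S a c
  reach-trans r here             = r
  reach-trans r (step r′ e w∈S) = step (reach-trans r r′) e w∈S

  reach-∈ : ∀ {S a b} → a ∈ S → Reach R S a b → b ∈ S
  reach-∈ a∈S here           = a∈S
  reach-∈ a∈S (step _ _ b∈S) = b∈S

  reach-sym : (∀ {u v} → R u v → R v u) → ∀ {S a b} → a ∈ S → Reach R S a b → Reach R S b a
  reach-sym R-sym a∈S here           = here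
  reach-sym R-sym a∈S (step r e w∈S) =
    reach-trans (step here (R-sym e) (reach-∈ a∈S r)) (reach-sym R-sym a∈S r)

  reach-exit : ∀ {S a b} (C : List (Fin n)) → Reach R S a b → a ∈ C → b ∉ C →
    ∃[ c ] ∃[ y ] (c ∈ C × y ∈ S × y ∉ C × R c y)
  reach-exit C here a∈C b∉C = contradiction a∈C b∉C
  reach-exit C (step {v = v} r e w∈S) a∈C w∉C with v ∈? C
  ... | yes v∈C = v , _ , v∈C , w∈S , w∉C , e
  ... | no v∉C  = reach-exit C r a∈C v∉C

  chain-reach : (∀ {u v} → R u v → R v u) → ∀ {S l a r} → Chain R l → l ⊆ S → a ∈ l →
    Reach R S r a → ∀ {v} → v ∈ l → Reach R S r v
  chain-reach R-sym []         l⊆S ()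
  chain-reach R-sym ([-] _)    l⊆S (here refl) r (here refl) = r
  chain-reach R-sym (e ∷ ch)   l⊆S (here refl) r (here refl) = r
  chain-reach R-sym (e ∷ ch)   l⊆S (here refl) r (there v∈) =
    chain-reach R-sym ch (l⊆S ∘ there) (here refl) (step r e (l⊆S (there (here refl)))) v∈
  chain-reach R-sym (e ∷ ch)   l⊆S (there a∈) r (here refl) =
    step (chain-reach R-sym ch (l⊆S ∘ there) a∈ r (here refl)) (R-sym e) (l⊆S (here refl))
  chain-reach R-sym (e ∷ ch)   l⊆S (there a∈) r (there v∈) =
    chain-reach R-sym ch (l⊆S ∘ there) a∈ r v∈

  chain-tail : ∀ {x l} → Chain R (x ∷ l) → Chain R l
  chain-tail ([-] _)  = []
  chain-tail (_ ∷ ch) = ch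

  chain-init : ∀ l {e} → Chain R (l ++ [ e ]) → Chain R l
  chain-init []            ch       = []
  chain-init (x ∷ [])      ch       = [-] x
  chain-init (x ∷ y ∷ l) (r ∷ ch) = r ∷ chain-init (y ∷ l) ch

  chain-first-step : ∀ {a b} l → Chain R (a ∷ l ++ [ b ]) → ∃[ z ] ((z ∈ l ⊎ z ≡ b) × R a z)
  chain-first-step []      (r ∷ _) = _ , inj₂ refl , r
  chain-first-step (x ∷ l) (r ∷ _) = x , inj₁ (here refl) , r

  chain-last-step : ∀ {a b} l → Chain R (a ∷ l ++ [ b ]) → ∃[ z ] ((z ∈ l ⊎ z ≡ a) × R z b)
  chain-last-step []      (r ∷ _)  = _ , inj₂ refl , r
  chain-last-step (x ∷ l) (_ ∷ ch) with chain-last-step l ch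
  ... | z , inj₁ z∈l , r = z , inj₁ (there z∈l) , r
  ... | z , inj₂ refl , r = z , inj₁ (here refl) , r

module _ {n : ℕ} {G : Graph n} (𝒫 : ShortcutSystem G) where

  InM? : ∀ v u → Dec (InM 𝒫 v u)
  InM? v u = map′ from to (any? (λ P → (start P ≟ u ⊎-dec end P ≟ u) ×-dec v ∈? inner P) 𝒫)
    where
    from : Any (λ P → (start P ≡ u ⊎ end P ≡ u) × v ∈ inner P) 𝒫 → InM 𝒫 v u
    from any with find any
    ... | P , P∈ , inj₁ s≡u , v∈ = P , end P   , P∈ , inj₁ (s≡u , refl) , v∈
    ... | P , P∈ , inj₂ e≡u , v∈ = P , start P , P∈ , inj₂ (refl , e≡u) , v∈
    to : InM 𝒫 v u → Any (λ P → (start P ≡ u ⊎ end P ≡ u) × v ∈ inner P) 𝒫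
    to (P , _ , P∈ , inj₁ (s≡u , _) , v∈) = lose P∈ (inj₁ s≡u , v∈)
    to (P , _ , P∈ , inj₂ (_ , e≡u) , v∈) = lose P∈ (inj₂ e≡u , v∈)

  AdjP-sym : ∀ {u v} → AdjP G 𝒫 u v → AdjP G 𝒫 v u
  AdjP-sym (inj₁ e)             = inj₁ (sym G e)
  AdjP-sym (inj₂ (P , P∈ , sc)) = inj₂ (P , P∈ , swap sc)

  detour : ∀ {u v} → AdjP G 𝒫 u v → List (Fin n)
  detour (inj₁ _)           = []
  detour (inj₂ (P , _ , _)) = inner P

  detour-length : ∀ {k} → (∀ {P} → P ∈ 𝒫 → pathLength P ≤ k) →
    ∀ {u v} (e : AdjP G 𝒫 u v) → length (detour e) ≤ k ∸ 1
  detour-length short (inj₁ _)           = z≤n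
  detour-length short (inj₂ (_ , P∈ , _)) = ∸-monoˡ-≤ 1 (short P∈)

  detour-InM : ∀ {u v w} (e : AdjP G 𝒫 u v) → w ∈ detour e → InM 𝒫 w v
  detour-InM (inj₂ (P , P∈ , sc)) w∈ = P , _ , P∈ , swap sc , w∈

  detour-neighbour : ∀ {u v} (e : AdjP G 𝒫 u v) → ∃[ z ] (z ∈ v ∷ detour e × Adj G u z)
  detour-neighbour (inj₁ uv) = _ , here refl , uv
  detour-neighbour (inj₂ (P , _ , inj₁ (refl , refl))) with chain-first-step (inner P) (adjacent P)
  ... | z , inj₁ z∈ , r    = z , there z∈ , r
  ... | z , inj₂ refl , r = z , here refl , r
  detour-neighbour (inj₂ (P , _ , inj₂ (refl , refl))) with chain-last-step (inner P) (adjacent P)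
  ... | z , inj₁ z∈ , r    = z , there z∈ , sym G r
  ... | z , inj₂ refl , r = z , here refl , sym G r

  detour-reach : ∀ {S r u v} (e : AdjP G 𝒫 u v) → v ∷ detour e ⊆ S → Reach (Adj G) S r v →
    ∀ {w} → w ∈ detour e → Reach (Adj G) S r w
  detour-reach {S} (inj₂ (P , _ , inj₁ (refl , refl))) ⊆S r w∈ =
    chain-reach (sym G) (chain-tail (adjacent P)) path⊆S (∈-++⁺ʳ (inner P) (here refl)) r (∈-++⁺ˡ w∈)
    where
    path⊆S : inner P ++ [ end P ] ⊆ S
    path⊆S q with ∈-++⁻ (inner P) q
    ... | inj₁ i          = ⊆S (there i)
    ... | inj₂ (here refl) = ⊆S (here refl)
  detour-reach (inj₂ (P , _ , inj₂ (refl , refl))) ⊆S r w∈ =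
    chain-reach (sym G) (chain-init (start P ∷ inner P) (adjacent P)) ⊆S (here refl) r (there w∈)

module ShortcutExpansion {n : ℕ} (G : Graph n) (𝒫 : ShortcutSystem G) {k : ℕ}
  (short : ∀ {P} → P ∈ 𝒫 → pathLength P ≤ k) (xs : List (Fin n)) where

  InteriorOf : List (Fin n) → Fin n → Set
  InteriorOf Y u = Any (InM 𝒫 u) Y

  record Expansion (Y : List (Fin n)) : Set where
    field
      Z U         : List (Fin n)
      Z-unique    : Unique Z
      Z⊆Y++U      : Z ⊆ Y ++ U
      U-interior  : ∀ {u} → u ∈ U → InteriorOf Y u
      U-length    : length U ≤ (k ∸ 1) * (length Y + length xs ∸ 1)
      Z-length    : length Z ≤ length Y + length U
      Z-connected : Connected (Adj G) Z
      Z-attached  : ∀ {x} → x ∈ xs → ∃[ z ] (z ∈ Z × Adj G x z)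

  private
    module Build (y₀ : Fin n) (Ys : List (Fin n))
      (Y-conn : ∀ {u v} → u ∈ y₀ ∷ Ys → v ∈ y₀ ∷ Ys → Reach (AdjP G 𝒫) (y₀ ∷ Ys) u v) where

      Y : List (Fin n)
      Y = y₀ ∷ Ys

      -- Yin ⊆ Y is connected to y₀ in G through the extra vertices U, and every vertex still
      -- pending in R keeps k ∸ 1 vertices of budget for the shortcut that will reach it.
      record Tree : Set where
        field
          Yin U R    : List (Fin n)
          Yin⊆Y      : Yin ⊆ Y
          y₀∈Yin     : y₀ ∈ Yin
          Y⊆Yin∪R    : ∀ {y} → y ∈ Y → y ∈ Yin ⊎ y ∈ R
          U-interior : ∀ {u} → u ∈ U → InteriorOf Y u
          reach      : ∀ {v} → v ∈ Yin ++ U → Reach (Adj G) (Yin ++ U) y₀ v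
          budget     : length U + (k ∸ 1) * length R ≤ (k ∸ 1) * length Ys

      record Hull (xs′ : List (Fin n)) : Set where
        field
          U          : List (Fin n)
          U-interior : ∀ {u} → u ∈ U → InteriorOf Y u
          reach      : ∀ {v} → v ∈ Y ++ U → Reach (Adj G) (Y ++ U) y₀ v
          U-length   : length U ≤ (k ∸ 1) * (length Ys + length xs′)
          attached   : ∀ {x} → x ∈ xs′ → ∃[ z ] (z ∈ Y ++ U × Adj G x z)

      seed : Tree
      seed = record
        { Yin = [ y₀ ] ; U = [] ; R = Ys
        ; Yin⊆Y      = λ { (here y≡y₀) → here y≡y₀ }
        ; y₀∈Yin     = here refl
        ; Y⊆Yin∪R    = λ { (here y≡y₀) → inj₁ (here y≡y₀) ; (there y∈) → inj₂ y∈ }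
        ; U-interior = λ ()
        ; reach      = λ { (here refl) → here }
        ; budget     = ≤-refl }

      extend : (T : Tree) → ∀ {c y} → c ∈ Tree.Yin T → y ∈ Y → (p : y ∈ Tree.R T) → AdjP G 𝒫 y c → Tree
      extend T {c} {y} c∈Yin y∈Y p e = record
        { Yin = y ∷ Yin ; U = detour 𝒫 e ++ U ; R = R ─ p
        ; Yin⊆Y      = λ { (here refl) → y∈Y ; (there q) → Yin⊆Y q }
        ; y₀∈Yin     = there y₀∈Yin
        ; Y⊆Yin∪R    = covered
        ; U-interior = interior
        ; reach      = reach′
        ; budget     = budget′ }
        where
        open Tree T
        new = (y ∷ Yin) ++ (detour 𝒫 e ++ U)
        old⊆new : Yin ++ U ⊆ new
        old⊆new = ++⁺ there (xs⊆ys++xs U (detour 𝒫 e))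
        path⊆new : c ∷ detour 𝒫 e ⊆ new
        path⊆new (here refl) = there (∈-++⁺ˡ c∈Yin)
        path⊆new (there d)   = ∈-++⁺ʳ (y ∷ Yin) (∈-++⁺ˡ d)
        reach-old : ∀ {v} → v ∈ Yin ++ U → Reach (Adj G) new y₀ v
        reach-old = reach-mono old⊆new ∘ reach
        reach-path : ∀ {v} → v ∈ c ∷ detour 𝒫 e → Reach (Adj G) new y₀ v
        reach-path (here refl) = reach-old (∈-++⁺ˡ c∈Yin)
        reach-path (there d)   = detour-reach 𝒫 e path⊆new (reach-old (∈-++⁺ˡ c∈Yin)) d
        reach′ : ∀ {v} → v ∈ new → Reach (Adj G) new y₀ v
        reach′ (here refl) with detour-neighbour 𝒫 e
        ... | z , z∈ , yz = step (reach-path z∈) (sym G yz) (here refl)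
        reach′ (there q) with ∈-++⁻ Yin q
        ... | inj₁ q′ = reach-old (∈-++⁺ˡ q′)
        ... | inj₂ q′ with ∈-++⁻ (detour 𝒫 e) q′
        ...   | inj₁ d = reach-path (there d)
        ...   | inj₂ u = reach-old (∈-++⁺ʳ Yin u)
        covered : ∀ {y′} → y′ ∈ Y → y′ ∈ y ∷ Yin ⊎ y′ ∈ (R ─ p)
        covered y′∈Y with Y⊆Yin∪R y′∈Y
        ... | inj₁ q = inj₁ (there q)
        ... | inj₂ q with ∈-─ p q
        ...   | inj₁ y′≡y = inj₁ (here y′≡y)
        ...   | inj₂ q′   = inj₂ q′
        interior : ∀ {u} → u ∈ detour 𝒫 e ++ U → InteriorOf Y u
        interior q with ∈-++⁻ (detour 𝒫 e) q
        ... | inj₁ d = lose (Yin⊆Y c∈Yin) (detour-InM 𝒫 e d)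
        ... | inj₂ u = U-interior u
        budget′ : length (detour 𝒫 e ++ U) + (k ∸ 1) * length (R ─ p) ≤ (k ∸ 1) * length Ys
        budget′ = begin
          length (detour 𝒫 e ++ U) + (k ∸ 1) * length (R ─ p)
            ≡⟨ cong (_+ (k ∸ 1) * length (R ─ p)) (length-++ (detour 𝒫 e)) ⟩
          length (detour 𝒫 e) + length U + (k ∸ 1) * length (R ─ p)
            ≤⟨ +-monoˡ-≤ _ (+-monoˡ-≤ _ (detour-length 𝒫 short e)) ⟩
          (k ∸ 1) + length U + (k ∸ 1) * length (R ─ p)
            ≡⟨ rearrange (k ∸ 1) (length U) (length (R ─ p)) ⟩
          length U + (k ∸ 1) * suc (length (R ─ p))
            ≡⟨ cong (λ r → length U + (k ∸ 1) * r) (≡-sym (length-─ p)) ⟩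
          length U + (k ∸ 1) * length R
            ≤⟨ budget ⟩
          (k ∸ 1) * length Ys ∎
          where
          open ≤-Reasoning
          rearrange : ∀ a b r → a + b + a * r ≡ b + a * suc r
          rearrange = solve-∀

      complete : (T : Tree) → Y ⊆ Tree.Yin T → Hull []
      complete T Y⊆Yin = record
        { U          = U
        ; U-interior = U-interior
        ; reach      = reach-mono (++⁺ Yin⊆Y (λ q → q)) ∘ reach ∘ ++⁺ Y⊆Yin (λ q → q)
        ; U-length   = ≤-trans (m≤m+n (length U) _)
                         (≤-trans budget (≤-reflexive (cong ((k ∸ 1) *_) (≡-sym (+-identityʳ (length Ys))))))
        ; attached   = λ () }
        where open Tree T

      grow : (T : Tree) → Acc _<_ (length (Tree.R T)) → Hull []
      grow T (acc smaller) with all? (_∈? Tree.Yin T) Y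
      ... | yes Y⊆Yin = complete T (All.lookup Y⊆Yin)
      ... | no Y⊈Yin with find (¬All⇒Any¬ (_∈? Tree.Yin T) Y Y⊈Yin)
      ... | y , y∈Y , y∉Yin
            with reach-exit (Tree.Yin T) (Y-conn (here refl) y∈Y) (Tree.y₀∈Yin T) y∉Yin
      ... | c , y′ , c∈Yin , y′∈Y , y′∉Yin , e with Tree.Y⊆Yin∪R T y′∈Y
      ... | inj₁ y′∈Yin = contradiction y′∈Yin y′∉Yin
      ... | inj₂ y′∈R   = grow (extend T c∈Yin y′∈Y y′∈R (AdjP-sym 𝒫 e))
                               (smaller (≤-reflexive (≡-sym (length-─ y′∈R))))

      attach : ∀ {xs′} → Hull xs′ → ∀ {x y} → y ∈ Y → AdjP G 𝒫 x y → Hull (x ∷ xs′)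
      attach {xs′} H {x} {y} y∈Y e = record
        { U          = detour 𝒫 e ++ U
        ; U-interior = interior
        ; reach      = reach′
        ; U-length   = length-bound
        ; attached   = attached′ }
        where
        open Hull H
        new = Y ++ (detour 𝒫 e ++ U)
        old⊆new : Y ++ U ⊆ new
        old⊆new = ++⁺ (λ q → q) (xs⊆ys++xs U (detour 𝒫 e))
        path⊆new : y ∷ detour 𝒫 e ⊆ new
        path⊆new (here refl) = ∈-++⁺ˡ y∈Y
        path⊆new (there d)   = ∈-++⁺ʳ Y (∈-++⁺ˡ d)
        reach-old : ∀ {v} → v ∈ Y ++ U → Reach (Adj G) new y₀ v
        reach-old = reach-mono old⊆new ∘ reach
        reach′ : ∀ {v} → v ∈ new → Reach (Adj G) new y₀ v
        reach′ q with ∈-++⁻ Y q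
        ... | inj₁ q′ = reach-old (∈-++⁺ˡ q′)
        ... | inj₂ q′ with ∈-++⁻ (detour 𝒫 e) q′
        ...   | inj₁ d = detour-reach 𝒫 e path⊆new (reach-old (∈-++⁺ˡ y∈Y)) d
        ...   | inj₂ u = reach-old (∈-++⁺ʳ Y u)
        interior : ∀ {u} → u ∈ detour 𝒫 e ++ U → InteriorOf Y u
        interior q with ∈-++⁻ (detour 𝒫 e) q
        ... | inj₁ d = lose y∈Y (detour-InM 𝒫 e d)
        ... | inj₂ u = U-interior u
        attached′ : ∀ {x′} → x′ ∈ x ∷ xs′ → ∃[ z ] (z ∈ new × Adj G x′ z)
        attached′ (here refl) with detour-neighbour 𝒫 e
        ... | z , z∈ , xz = z , path⊆new z∈ , xz
        attached′ (there q) with attached q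
        ... | z , z∈ , xz = z , old⊆new z∈ , xz
        length-bound : length (detour 𝒫 e ++ U) ≤ (k ∸ 1) * (length Ys + suc (length xs′))
        length-bound = begin
          length (detour 𝒫 e ++ U)                   ≡⟨ length-++ (detour 𝒫 e) ⟩
          length (detour 𝒫 e) + length U             ≤⟨ +-mono-≤ (detour-length 𝒫 short e) U-length ⟩
          (k ∸ 1) + (k ∸ 1) * (length Ys + length xs′) ≡⟨ rearrange (k ∸ 1) (length Ys) (length xs′) ⟩
          (k ∸ 1) * (length Ys + suc (length xs′))   ∎
          where
          open ≤-Reasoning
          rearrange : ∀ a b c → a + a * (b + c) ≡ a * (b + suc c)
          rearrange = solve-∀

      attach-all : ∀ xs′ → (∀ {x} → x ∈ xs′ → ∃[ y ] (y ∈ Y × AdjP G 𝒫 x y)) → Hull xs′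
      attach-all []        _   = grow seed (<-wellFounded _)
      attach-all (x ∷ xs′) att with att (here refl)
      ... | y , y∈Y , e = attach (attach-all xs′ (att ∘ there)) y∈Y e

  expand : ∀ {Y} → Connected (AdjP G 𝒫) Y →
    (∀ {x} → x ∈ xs → ∃[ y ] (y ∈ Y × AdjP G 𝒫 x y)) → Expansion Y
  expand {[]}      (Y≢[] , _)    _   = contradiction refl Y≢[]
  expand {y₀ ∷ Ys} (_ , Y-conn) att = record
    { Z           = Z
    ; U           = U
    ; Z-unique    = deduplicate-! _≟_ (Y ++ U)
    ; Z⊆Y++U      = ∈-deduplicate⁻ _≟_ (Y ++ U)
    ; U-interior  = U-interior
    ; U-length    = U-length
    ; Z-length    = ≤-trans (length-deduplicate _≟_ (Y ++ U)) (≤-reflexive (length-++ Y))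
    ; Z-connected = (λ Z≡[] → case-[] (subst (y₀ ∈_) Z≡[] y₀∈Z))
                  , λ u∈ v∈ → reach-trans (reach-sym (sym G) y₀∈Z (reach-Z u∈)) (reach-Z v∈)
    ; Z-attached  = attached-Z }
    where
    open Build y₀ Ys Y-conn
    open Hull (attach-all xs att)
    Z = deduplicate _≟_ (Y ++ U)
    case-[] : y₀ ∉ []
    case-[] ()
    y₀∈Z : y₀ ∈ Z
    y₀∈Z = ∈-deduplicate⁺ _≟_ {xs = Y ++ U} (here refl)
    reach-Z : ∀ {v} → v ∈ Z → Reach (Adj G) Z y₀ v
    reach-Z = reach-mono (∈-deduplicate⁺ _≟_) ∘ reach ∘ ∈-deduplicate⁻ _≟_ (Y ++ U)
    attached-Z : ∀ {x} → x ∈ xs → ∃[ z ] (z ∈ Z × Adj G x z)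
    attached-Z x∈ with attached x∈
    ... | z , z∈ , xz = z , ∈-deduplicate⁺ _≟_ z∈ , xz

module Witnesses {J A : Set} (Y : J → List A)
  (Y-disjoint : ∀ {j j′} → j ≢ j′ → ∀ {a} → a ∈ Y j → a ∉ Y j′) where

  Located : (A → Set) → (J → Set) → List J → A → Set
  Located M Q L w = M w × ∃[ j ] (j ∈ L × Q j × w ∈ Y j)

  witnesses : {M : A → Set} {Q : J → Set} (Q? : Decidable Q) → (∀ {j} → Q j → Any M (Y j)) →
    ∀ {L} → Unique L → ∃[ ws ] (Unique ws × length ws ≡ count Q? L × (∀ {w} → w ∈ ws → Located M Q L w))
  witnesses Q? meets {[]}    []           = [] , [] , refl , λ ()
  witnesses {M} {Q} Q? meets {j ∷ L} (j∉L ∷ uL) with Q? j | witnesses Q? meets uL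
  ... | no _  | ws , u , len , located = ws , u , len , located′
    where
    located′ : ∀ {w} → w ∈ ws → Located M Q (j ∷ L) w
    located′ w∈ with located w∈
    ... | mw , j′ , j′∈L , rest = mw , j′ , there j′∈L , rest
  ... | yes qj | ws , u , len , located with find (meets qj)
  ...   | w , w∈Y , mw = w ∷ ws , All.tabulate fresh ∷ u , cong suc len , located′
    where
    fresh : ∀ {w′} → w′ ∈ ws → w ≢ w′
    fresh w′∈ refl with located w′∈
    ... | _ , j′ , j′∈L , _ , w∈Y′ = Y-disjoint (All.lookup j∉L j′∈L) w∈Y w∈Y′
    located′ : ∀ {w′} → w′ ∈ w ∷ ws → Located M Q (j ∷ L) w′
    located′ (here refl) = mw , j , here refl , qj , w∈Y
    located′ (there w′∈) with located w′∈
    ... | mw′ , j′ , j′∈L , rest = mw′ , j′ , there j′∈L , rest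

CardLe-≡ : ∀ {n} (v : Fin n) → CardLe (_≡ v) 1
CardLe-≡ v []               _                 _    = z≤n
CardLe-≡ v (_ ∷ [])         _                 _    = s≤s z≤n
CardLe-≡ v (u ∷ u′ ∷ _) ((u≢u′ ∷ _) ∷ _) all≡v =
  contradiction (trans (all≡v (here refl)) (≡-sym (all≡v (there (here refl))))) u≢u′

module Contraction {n : ℕ} {G : Graph n} {𝒫 : ShortcutSystem G} {k d : ℕ} (kd : IsKDStar 𝒫 k d)
  {s q m : ℕ} (H : Model (AdjP G 𝒫) 1 q s m) where

  open Model H

  x : Fin s → Fin n
  x i = proj₁ (nonempty-≤1⇒singleton (proj₁ (X-conn i)) (X-size i))

  X≡[x] : ∀ i → X i ≡ [ x i ]
  X≡[x] i = proj₂ (nonempty-≤1⇒singleton (proj₁ (X-conn i)) (X-size i))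

  ∈X⇒≡x : ∀ i {v} → v ∈ X i → v ≡ x i
  ∈X⇒≡x i v∈X with here v≡x ← subst (_ ∈_) (X≡[x] i) v∈X = v≡x

  x∈X : ∀ i → x i ∈ X i
  x∈X i = subst (x i ∈_) (≡-sym (X≡[x] i)) (here refl)

  xs : List (Fin n)
  xs = map x (allFin s)

  length-xs : length xs ≡ s
  length-xs = trans (length-map x (allFin s)) (length-tabulate (λ i → i))

  attachment : ∀ j {v} → v ∈ xs → ∃[ y ] (y ∈ Y j × AdjP G 𝒫 v y)
  attachment j v∈xs with ∈-map⁻ x v∈xs
  ... | i , _ , refl with edge i j
  ...   | x′ , y , x′∈X , y∈Y , e = y , y∈Y , subst (λ u → AdjP G 𝒫 u y) (∈X⇒≡x i x′∈X) e

  open ShortcutExpansion G 𝒫 (proj₁ kd) xs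

  expansion : ∀ j → Expansion (Y j)
  expansion j = expand (Y-conn j) (attachment j)

  open module Exp (j : Fin m) = Expansion (expansion j)
    using (Z; U; Z-unique; Z⊆Y++U; U-interior; Z-connected; Z-attached)

  K : ℕ
  K = (k ∸ 1) * (s + q ∸ 1)

  U-length≤K : ∀ j → length (U j) ≤ K
  U-length≤K j = ≤-trans (Exp.U-length j) (*-monoʳ-≤ (k ∸ 1) (∸-monoˡ-≤ 1 (begin
    length (Y j) + length xs  ≡⟨ cong (length (Y j) +_) length-xs ⟩
    length (Y j) + s          ≤⟨ +-monoˡ-≤ s (Y-size j) ⟩
    q + s                     ≡⟨ +-comm q s ⟩
    s + q                     ∎)))
    where open ≤-Reasoning

  Z-length≤ : ∀ j → length (Z j) ≤ q + K
  Z-length≤ j = ≤-trans (Exp.Z-length j) (+-mono-≤ (Y-size j) (U-length≤K j))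

  open Witnesses Y (λ j≢j′ → YY-disj _ _ j≢j′)

  count≤card : ∀ {M : Fin n → Set} {c} → CardLe M c → {Q : Fin m → Set} (Q? : Decidable Q) →
    (∀ {j} → Q j → Any M (Y j)) → ∀ {L} → Unique L → count Q? L ≤ c
  count≤card card Q? meets uL with witnesses Q? meets uL
  ... | ws , u , len , located = ≤-trans (≤-reflexive (≡-sym len)) (card ws u (proj₁ ∘ located))

  Bad : Fin m → Set
  Bad j = Any (InteriorOf (Y j)) xs

  bad? : Decidable Bad
  bad? j = any? (λ v → any? (InM? 𝒫 v) (Y j)) xs

  bad-count : ∀ {L} → Unique L → count bad? L ≤ s * d
  bad-count {L} uL = begin
    count bad? L
      ≤⟨ count-Any bad? (λ v j → any? (InM? 𝒫 v) (Y j)) xs (λ bad → bad) L ⟩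
    sum (map (λ v → count (λ j → any? (InM? 𝒫 v) (Y j)) L) xs)
      ≤⟨ sum-map-≤ xs (λ {v} _ → count≤card (proj₂ kd v) (λ j → any? (InM? 𝒫 v) (Y j)) (λ i → i) uL) ⟩
    length xs * d
      ≡⟨ cong (_* d) length-xs ⟩
    s * d ∎
    where open ≤-Reasoning

  many-good : m ≤ length (filter (¬? ∘ bad?) (allFin m)) + s * d
  many-good = begin
    m
      ≡⟨ ≡-sym (length-tabulate (λ i → i)) ⟩
    length (allFin m)
      ≡⟨ ≡-sym (count+count¬≡length bad? (allFin m)) ⟩
    count bad? (allFin m) + count (¬? ∘ bad?) (allFin m)
      ≡⟨ +-comm (count bad? (allFin m)) _ ⟩
    count (¬? ∘ bad?) (allFin m) + count bad? (allFin m)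
      ≤⟨ +-mono-≤ (≤-reflexive (≡-sym (length-filter≡count (¬? ∘ bad?) (allFin m)))) (bad-count (allFin⁺ m)) ⟩
    length (filter (¬? ∘ bad?) (allFin m)) + s * d ∎
    where open ≤-Reasoning

  Elsewhere : Fin m → Fin n → Fin m → Set
  Elsewhere j v j′ = j′ ≢ j × InteriorOf (Y j′) v

  elsewhere? : ∀ j v → Decidable (Elsewhere j v)
  elsewhere? j v j′ = ¬? (j′ ≟ j) ×-dec any? (InM? 𝒫 v) (Y j′)

  Clash : Fin m → Fin n → Fin m → Set
  Clash j v j′ = Elsewhere j v j′ ⊎ v ∈ Y j′

  clash? : ∀ j v → Decidable (Clash j v)
  clash? j v j′ = elsewhere? j v j′ ⊎-dec v ∈? Y j′

  Conflict : Fin m → Fin m → Set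
  Conflict j j′ = Any (λ v → Clash j v j′) (U j)

  conflict? : ∀ j j′ → Dec (Conflict j j′)
  conflict? j j′ = any? (λ v → clash? j v j′) (U j)

  clash-count : ∀ {j v} → v ∈ U j → ∀ {L} → Unique L → count (clash? j v) L ≤ d
  clash-count {j} {v} v∈U {L} uL with find (U-interior j v∈U) | witnesses (elsewhere? j v) proj₂ uL
  ... | yⱼ , yⱼ∈Y , yⱼ-InM | ws , u , len , located = begin
    count (clash? j v) L
      ≤⟨ count-⊎ (elsewhere? j v) (λ j′ → v ∈? Y j′) L ⟩
    count (elsewhere? j v) L + count (λ j′ → v ∈? Y j′) L
      ≤⟨ +-monoʳ-≤ _ (count≤card (CardLe-≡ v) (λ j′ → v ∈? Y j′) (λ v∈ → lose v∈ refl) uL) ⟩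
    count (elsewhere? j v) L + 1
      ≡⟨ +-comm _ 1 ⟩
    suc (count (elsewhere? j v) L)
      ≡⟨ cong suc (≡-sym len) ⟩
    length (yⱼ ∷ ws)
      ≤⟨ proj₂ kd v (yⱼ ∷ ws) (All.tabulate fresh ∷ u) all-InM ⟩
    d ∎
    where
    open ≤-Reasoning
    fresh : ∀ {w} → w ∈ ws → yⱼ ≢ w
    fresh w∈ refl with located w∈
    ... | _ , j′ , _ , (j′≢j , _) , w∈Y′ = YY-disj j j′ (j′≢j ∘ ≡-sym) yⱼ∈Y w∈Y′
    all-InM : ∀ {w} → w ∈ yⱼ ∷ ws → InM 𝒫 v w
    all-InM (here refl) = yⱼ-InM
    all-InM (there w∈)  = proj₁ (located w∈)

  conflict-count : ∀ j {L} → Unique L → count (conflict? j) L ≤ K * d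
  conflict-count j {L} uL = begin
    count (conflict? j) L
      ≤⟨ count-Any (conflict? j) (clash? j) (U j) (λ conflict → conflict) L ⟩
    sum (map (λ v → count (clash? j v) L) (U j))
      ≤⟨ sum-map-≤ (U j) (λ v∈U → clash-count v∈U uL) ⟩
    length (U j) * d
      ≤⟨ *-monoˡ-≤ d (U-length≤K j) ⟩
    K * d ∎
    where open ≤-Reasoning

  Z-disjoint : ∀ {j j′} → j ≢ j′ → ¬ Conflict j j′ → ¬ Conflict j′ j → Disjoint (Z j) (Z j′)
  Z-disjoint {j} {j′} j≢j′ ¬jj′ ¬j′j v∈Z v∈Z′
    with ∈-++⁻ (Y j) (Z⊆Y++U j v∈Z) | ∈-++⁻ (Y j′) (Z⊆Y++U j′ v∈Z′)
  ... | inj₁ v∈Y | inj₁ v∈Y′ = YY-disj j j′ j≢j′ v∈Y v∈Y′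
  ... | inj₂ v∈U | inj₁ v∈Y′ = ¬jj′ (lose v∈U (inj₂ v∈Y′))
  ... | inj₁ v∈Y | inj₂ v∈U′ = ¬j′j (lose v∈U′ (inj₂ v∈Y))
  ... | inj₂ v∈U | inj₂ v∈U′ = ¬jj′ (lose v∈U (inj₁ (j≢j′ ∘ ≡-sym , U-interior j′ v∈U′)))

  X-Z-disjoint : ∀ i {j} → ¬ Bad j → Disjoint (X i) (Z j)
  X-Z-disjoint i {j} good v∈X v∈Z with ∈-++⁻ (Y j) (Z⊆Y++U j v∈Z)
  ... | inj₁ v∈Y = XY-disj i j v∈X v∈Y
  ... | inj₂ v∈U = good (lose (∈-map⁺ x (∈-allFin i))
                               (subst (InteriorOf (Y j)) (∈X⇒≡x i v∈X) (U-interior j v∈U)))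

  contracted-model : ∀ {t} (sel : Fin t → Fin m) → Injective _≡_ _≡_ sel → (∀ a → ¬ Bad (sel a)) →
    (∀ {a a′} → a ≢ a′ → ¬ Conflict (sel a) (sel a′)) → Model (Adj G) 1 (q + K) s t
  contracted-model sel sel-injective sel-good sel-independent = record
    { X        = X
    ; Y        = Z ∘ sel
    ; X-unique = X-unique
    ; Y-unique = Z-unique ∘ sel
    ; X-conn   = λ i → proj₁ (X-conn i) , λ u∈ v∈ →
                   subst (Reach (Adj G) (X i) _) (trans (∈X⇒≡x i u∈) (≡-sym (∈X⇒≡x i v∈))) here
    ; Y-conn   = Z-connected ∘ sel
    ; XX-disj  = XX-disj
    ; YY-disj  = λ a a′ a≢a′ → Z-disjoint (a≢a′ ∘ sel-injective)
                                 (sel-independent a≢a′) (sel-independent (a≢a′ ∘ ≡-sym))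
    ; XY-disj  = λ i a → X-Z-disjoint i (sel-good a)
    ; edge     = edge′
    ; X-size   = X-size
    ; Y-size   = Z-length≤ ∘ sel }
    where
    edge′ : ∀ i a → ∃[ u ] ∃[ z ] (u ∈ X i × z ∈ Z (sel a) × Adj G u z)
    edge′ i a with Z-attached (sel a) (∈-map⁺ x (∈-allFin i))
    ... | z , z∈Z , xz = x i , z , x∈X i , z∈Z , xz

enough-good-indices : ∀ d k′ r t g c → (2 * d * k′ * r + 1) * (t ∸ 1) + 1 + c ≤ g + c →
  suc (k′ * r * d + k′ * r * d) * t ≤ g + (k′ * r * d + k′ * r * d)
enough-good-indices d k′ r zero    g c _     = subst (_≤ g + E) (≡-sym (*-zeroʳ (suc E))) z≤n
  where E = k′ * r * d + k′ * r * d
enough-good-indices d k′ r (suc t) g c bound = begin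
  suc E * suc t                  ≡⟨ rearrange d k′ r t ⟩
  E + ((2 * d * k′ * r + 1) * t + 1) ≤⟨ +-monoʳ-≤ E (+-cancelʳ-≤ c _ _ bound) ⟩
  E + g                          ≡⟨ +-comm E g ⟩
  g + E                          ∎
  where
  open ≤-Reasoning
  E = k′ * r * d + k′ * r * d
  rearrange : ∀ d k′ r t → suc (k′ * r * d + k′ * r * d) * suc t ≡
                (k′ * r * d + k′ * r * d) + ((2 * d * k′ * r + 1) * t + 1)
  rearrange = solve-∀

corollary10 : ∀ (s t k d q : ℕ) {n : ℕ} (G : Graph n) (𝒫 : ShortcutSystem G) →
    IsKDStar 𝒫 k d →
    Model (AdjP G 𝒫) 1 q s ((2 * d * (k ∸ 1) * (s + q ∸ 1) + 1) * (t ∸ 1) + 1 + s * d) →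
    Model (Adj G) 1 (q + (k ∸ 1) * (s + q ∸ 1)) s t
corollary10 s t k d q G 𝒫 kd H =
  contracted-model pick pick-injective (proj₂ ∘ ∈-filter⁻ (¬? ∘ bad?) {xs = allFin _} ∘ pick-∈) pick-independent
  where
  open Contraction kd H
  open IndependentSet _≟_ conflict? (K * d) conflict-count
  open Independent (independent t (filter⁺ (¬? ∘ bad?) (allFin⁺ _))
    (enough-good-indices d (k ∸ 1) (s + q ∸ 1) t _ (s * d) many-good))
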